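{- Let $n$ be a positive integer and let $C_n$ denote the cyclic group of order $n$. Then the power graph $\mathcal{P}(C_n)$ is cyclically separable if and only if all of the following hold: (i) $n$ has at least two distinct prime factors; (ii) $n \neq p_1p_2$ for any primes $p_1 < p_2$ with $p_1 \in \{2,3\}$; (iii) $n \neq 12$.
   Context: All graphs are finite, simple and undirected. The power graph $\mathcal{P}(G)$ of a group $G$ is the graph with vertex set $G$ in which two distinct vertices are adjacent if one of them is a positive power of the other. For a graph $\Gamma$, a set $S$ of vertices is a vertex cutset if $\Gamma - S$ is disconnected; it is a cyclic vertex cutset if $\Gamma - S$ is disconnected and has at least two components each of which contains a cycle. $\Gamma$ is cyclically separable if it has a cyclic vertex cutset. -}

module Defs where

open import Level using (0ℓ)
open import Data.Nat using (ℕ; zero; suc; _+_; _*_; _≤_; _<_)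
open import Data.Nat.Primality using (Prime)
open import Data.Nat.Divisibility using (_∣_)
open import Data.Fin using (Fin; toℕ)
open import Data.Fin.Subset using (Subset; _∉_)
open import Data.List using (List; _∷_; []; _++_; [_]; length)
open import Data.List.Relation.Unary.All using (All)
open import Data.List.Relation.Unary.Linked using (Linked)
open import Data.List.Relation.Unary.Unique.Propositional using (Unique)
open import Data.Product using (Σ; ∃; ∃-syntax; _×_; _,_)
open import Data.Sum using (_⊎_)
open import Relation.Nullary using (¬_)
open import Relation.Binary.PropositionalEquality using (_≡_; _≢_)

module GraphDefs {V : Set} (E : V → V → Set) where

  data Reach (S : V → Set) : V → V → Set where
    here  : ∀ {u} → ¬ S u → Reach S u u
    there : ∀ {u v w} → ¬ S u → E u v → Reach S v w → Reach S u w

  IsCycleAvoiding : (S : V → Set) → V → List V → Set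
  IsCycleAvoiding S x xs =
    2 ≤ length xs × Unique (x ∷ xs) × All (λ y → ¬ S y) (x ∷ xs)
      × Linked E ((x ∷ xs) ++ [ x ])

  ComponentHasCycle : (S : V → Set) → V → Set
  ComponentHasCycle S u =
    ∃[ x ] ∃[ xs ] (IsCycleAvoiding S x xs × Reach S u x)

  IsCyclicVertexCutset : (S : V → Set) → Set
  IsCyclicVertexCutset S =
    ∃[ u ] ∃[ v ] (¬ S u × ¬ S v × ¬ Reach S u v
                   × ComponentHasCycle S u × ComponentHasCycle S v)

-- Cyclic group C_n, modelled as ℤ/nℤ = Fin n (residues 0 … n-1) under
-- addition mod n.  The k-th power of x is k·x mod n.

IsPower : (n : ℕ) → Fin n → Fin n → ℕ → Set
IsPower n y x k = ∃[ q ] (k * toℕ x ≡ q * n + toℕ y)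

IsPositivePower : (n : ℕ) → Fin n → Fin n → Set
IsPositivePower n y x = ∃[ k ] (1 ≤ k × IsPower n y x k)

PowerAdj : (n : ℕ) → Fin n → Fin n → Set
PowerAdj n x y = x ≢ y × (IsPositivePower n y x ⊎ IsPositivePower n x y)

CyclicallySeparablePowerGraph : ℕ → Set
CyclicallySeparablePowerGraph n =
  ∃[ S ] IsCyclicVertexCutset (λ v → v ∈S S)
  where
    open GraphDefs (PowerAdj n)
    _∈S_ : Fin n → Subset n → Set
    v ∈S S = Data.Fin.Subset._∈_ v S

HasTwoDistinctPrimeFactors : ℕ → Set
HasTwoDistinctPrimeFactors n =
  ∃[ p ] ∃[ q ] (Prime p × Prime q × p ≢ q × p ∣ n × q ∣ n)

IsSmallSemiprime : ℕ → Set
IsSmallSemiprime n =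
  ∃[ p₁ ] ∃[ p₂ ] (Prime p₁ × Prime p₂ × p₁ < p₂
                   × (p₁ ≡ 2 ⊎ p₁ ≡ 3) × n ≡ p₁ * p₂)

-- In ℤ/n the residues x and gcd x n generate the same subgroup, so x and y are adjacent in the
-- power graph exactly when the subgroups they generate are nested.
--
-- If n = m a with m ≥ 4 and 2 ≤ j ≤ m − 2, the residues a, j a and (m − 1) a of the subgroup
-- of order m form a triangle, and i′ b (where n = m′ b) can be adjacent to a vertex i a only if
-- m ∣ i m′ or m′ ∣ i′ m. Two triangles without edges between them, with every other vertex
-- deleted, give a cyclic vertex cutset. Under (i)–(iii) a suitable pair of orders always divides
-- n: coprime m, m′ ≥ 4; or p r and r² for primes p ≠ r with r ≥ 3; or 6 and 8.
--
-- Conversely, a clique K such that no path on three vertices avoids K meets every cycle, so all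
-- cycles of Γ − S lie in one component; prime powers, p q with p ≤ 3, and 12 all have one.

module Submission where

open import Defs
open import Data.Nat.Base
  using (ℕ; zero; suc; _+_; _*_; _∸_; _^_; _≤_; _<_; z≤n; s≤s
        ; NonZero; >-nonZero; ≢-nonZero⁻¹; nonTrivial⇒n>1)
open import Data.Nat.Properties
open import Data.Nat.Divisibility
open import Data.Nat.GCD
  using (gcd; gcd-GCD; gcd-identityˡ; gcd-greatest; gcd[m,n]∣m; gcd[m,n]∣n; module Bézout)
open import Data.Nat.Coprimality using (Coprime; coprime?; coprime-divisor)
import Data.Nat.Coprimality as Coprime
open import Data.Nat.Primality
open import Data.Nat.Primality.Factorisation using (factorise)
open import Data.Nat.ListAction using (product)
open import Data.Nat.Solver using (module +-*-Solver)
open import Data.Fin.Base using (Fin; toℕ; fromℕ<)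
open import Data.Fin.Properties
  using (toℕ<n; toℕ-fromℕ<; toℕ-injective; all?) renaming (_≟_ to _≟ᶠ_)
open import Data.Fin.Subset using (Subset; _∪_; ⁅_⁆; ∁) renaming (_∈_ to _∈ₛ_)
open import Data.Fin.Subset.Properties
  using (x∈⁅x⁆; x∈⁅y⁆⇒x≡y; x∈p∪q⁺; x∈p∪q⁻; x∈p⇒x∉∁p; x∉∁p⇒x∈p)
open import Data.List.Base using (List; []; _∷_; length)
open import Data.List.Membership.Propositional using (_∈_)
open import Data.List.Relation.Unary.Any using (here; there)
open import Data.List.Relation.Unary.All using (All; []; _∷_)
import Data.List.Relation.Unary.All as All
open import Data.List.Relation.Unary.AllPairs using ([]; _∷_)
open import Data.List.Relation.Unary.Linked using ([-]; _∷_)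
open import Data.Product using (∃-syntax; _×_; _,_; proj₁)
open import Data.Sum using (_⊎_; inj₁; inj₂; [_,_]′) renaming (map to ⊎-map)
open import Data.Unit using (⊤; tt)
open import Data.Empty using (⊥; ⊥-elim)
open import Function.Base using (_∘_)
open import Function.Bundles using (_⇔_; mk⇔)
open import Relation.Nullary using (¬_; yes; no; Dec)
open import Relation.Nullary.Decidable using (from-yes; from-no; _⊎-dec_; _×-dec_; _→-dec_; ¬?)
open import Relation.Unary using (Decidable)
open import Relation.Binary.Definitions using (DecidableEquality)
open import Relation.Binary.PropositionalEquality
open +-*-Solver using (solve; _:=_; _:+_; _:*_; con)

module SimpleGraph {V : Set} (E : V → V → Set)
  (E-sym : ∀ {u v} → E u v → E v u) (E-irrefl : ∀ {u v} → E u v → u ≢ v) where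

  open GraphDefs E public

  reach-start : ∀ {S u v} → Reach S u v → ¬ S u
  reach-start (here u∉S)      = u∉S
  reach-start (there u∉S _ _) = u∉S

  reach-end : ∀ {S u v} → Reach S u v → ¬ S v
  reach-end (here v∉S)    = v∉S
  reach-end (there _ _ r) = reach-end r

  reach-trans : ∀ {S u v w} → Reach S u v → Reach S v w → Reach S u w
  reach-trans (here _)        r′ = r′
  reach-trans (there u∉S e r) r′ = there u∉S e (reach-trans r r′)

  reach-sym : ∀ {S u v} → Reach S u v → Reach S v u
  reach-sym (here v∉S)      = here v∉S
  reach-sym (there u∉S e r) =
    reach-trans (reach-sym r) (there (reach-start r) (E-sym e) (here u∉S))

  -- Three consecutive vertices of a cycle are pairwise distinct, so one of
  -- them lies in K; as K is a clique, all cycle-carrying components meet.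
  no-cyclic-cutset : (K : V → Set) → Decidable K → DecidableEquality V →
    (∀ {u v} → K u → K v → u ≢ v → E u v) →
    (∀ {u v w} → ¬ K u → ¬ K v → ¬ K w → u ≢ w → E u v → E v w → ⊥) →
    ∀ S → ¬ IsCyclicVertexCutset S
  no-cyclic-cutset K K? _≟_ K-clique no-path S (u , v , _ , _ , u↮v , u-cyc , v-cyc) =
    u↮v u↝v
    where
    reaches-K : ∀ {u} → ComponentHasCycle S u → ∃[ w ] (K w × Reach S u w)
    reaches-K (_ , []     , (()    , _) , _)
    reaches-K (_ , _ ∷ [] , (s≤s () , _) , _)
    reaches-K (x , y ∷ z ∷ _ , (_ , (_ ∷ x≢z ∷ _) ∷ _ , x∉S ∷ y∉S ∷ z∉S ∷ _ , xy ∷ yz ∷ _) , u↝x)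
      with K? x | K? y | K? z
    ... | yes x∈K | _       | _       = x , x∈K , u↝x
    ... | no _    | yes y∈K | _       = y , y∈K , reach-trans u↝x (there x∉S xy (here y∉S))
    ... | no _    | no _    | yes z∈K =
      z , z∈K , reach-trans u↝x (there x∉S xy (there y∉S yz (here z∉S)))
    ... | no x∉K  | no y∉K  | no z∉K  = ⊥-elim (no-path x∉K y∉K z∉K x≢z xy yz)
    u↝v : Reach S u v
    u↝v with reaches-K u-cyc | reaches-K v-cyc
    ... | w , w∈K , u↝w | w′ , w′∈K , v↝w′ with w ≟ w′
    ... | yes refl = reach-trans u↝w (reach-sym v↝w′)
    ... | no w≢w′  =
      reach-trans u↝w (there (reach-end u↝w) (K-clique w∈K w′∈K w≢w′) (reach-sym v↝w′))

  record Triangle : Set where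
    field
      x y z : V
      xy : E x y
      yz : E y z
      zx : E z x

  _∈△_ : V → Triangle → Set
  v ∈△ T = v ≡ x ⊎ v ≡ y ⊎ v ≡ z
    where open Triangle T

  triangle-cycle : ∀ {S} (T : Triangle) → (∀ {v} → v ∈△ T → ¬ S v) →
    ComponentHasCycle S (Triangle.x T)
  triangle-cycle T T∌S =
    x , y ∷ z ∷ [] ,
    (s≤s (s≤s z≤n) ,
     (E-irrefl xy ∷ (λ x≡z → E-irrefl zx (sym x≡z)) ∷ []) ∷ (E-irrefl yz ∷ []) ∷ [] ∷ [] ,
     x∉S ∷ y∉S ∷ z∉S ∷ [] ,
     xy ∷ yz ∷ zx ∷ [-]) ,
    here x∉S
    where
    open Triangle T
    x∉S = T∌S (inj₁ refl)
    y∉S = T∌S (inj₂ (inj₁ refl))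
    z∉S = T∌S (inj₂ (inj₂ refl))

  two-triangles-cutset : (S : V → Set) (T U : Triangle) →
    (∀ {v} → v ∈△ T ⊎ v ∈△ U → ¬ S v) →
    (∀ {v} → ¬ S v → v ∈△ T ⊎ v ∈△ U) →
    (∀ {u v} → u ∈△ T → v ∈△ U → ¬ E u v) →
    IsCyclicVertexCutset S
  two-triangles-cutset S T U kept kept⁻ no-edge =
    Triangle.x T , Triangle.x U , kept (inj₁ (inj₁ refl)) , kept (inj₂ (inj₁ refl)) ,
    separated , triangle-cycle T (kept ∘ inj₁) , triangle-cycle U (kept ∘ inj₂)
    where
    stays-in-T : ∀ {u v} → Reach S u v → u ∈△ T → v ∈△ T
    stays-in-T (here _)      u∈T = u∈T
    stays-in-T (there _ e r) u∈T with kept⁻ (reach-start r)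
    ... | inj₁ w∈T = stays-in-T r w∈T
    ... | inj₂ w∈U = ⊥-elim (no-edge u∈T w∈U e)
    separated : ¬ Reach S (Triangle.x T) (Triangle.x U)
    separated r = no-edge (stays-in-T r (inj₁ refl)) (inj₂ (inj₁ refl)) (Triangle.xy U)

positivePower⇒gcd∣ : ∀ {n} {x y : Fin n} → IsPositivePower n y x → gcd (toℕ x) n ∣ toℕ y
positivePower⇒gcd∣ {n} {x} (k , _ , q , eq) =
  ∣m+n∣m⇒∣n (subst (gcd (toℕ x) n ∣_) eq (∣n⇒∣m*n k (gcd[m,n]∣m (toℕ x) n)))
    (∣n⇒∣m*n q (gcd[m,n]∣n (toℕ x) n))

-- Bézout's identity with a nonnegative multiple of x: k x ≡ gcd x n (mod n).
gcd≡multiple-mod : ∀ x n → ∃[ k ] ∃[ q ] (k * suc x ≡ q * n + gcd (suc x) n)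
gcd≡multiple-mod x n with Bézout.identity (gcd-GCD (suc x) n)
... | Bézout.+- X Y eq = X , Y , trans (sym eq) (+-comm (gcd (suc x) n) (Y * n))
... | Bézout.-+ X Y eq = Y * n ∸ X , Y * x , +-cancelʳ-≡ (X * suc x) _ _ (begin
    (Y * n ∸ X) * suc x + X * suc x ≡⟨ *-distribʳ-+ (suc x) (Y * n ∸ X) X ⟨
    (Y * n ∸ X + X) * suc x          ≡⟨ cong (_* suc x) (m∸n+n≡m X≤Yn) ⟩
    Y * n * suc x
      ≡⟨ solve 3 (λ x Y n → Y :* n :* (con 1 :+ x) := Y :* x :* n :+ Y :* n) refl x Y n ⟩
    Y * x * n + Y * n                ≡⟨ cong (Y * x * n +_) eq ⟨
    Y * x * n + (d + X * suc x)      ≡⟨ +-assoc (Y * x * n) d (X * suc x) ⟨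
    Y * x * n + d + X * suc x        ∎)
  where
  open ≡-Reasoning
  d = gcd (suc x) n
  X≤Yn : X ≤ Y * n
  X≤Yn = ≤-trans (m≤m*n X (suc x)) (≤-trans (m≤n+m (X * suc x) d) (≤-reflexive eq))

-- The multiple has to be positive, so y = 0 is reached as n x rather than 0 x.
gcd∣⇒multiple-mod : ∀ {n x y} → y < n → gcd x n ∣ y → ∃[ k ] (1 ≤ k × ∃[ q ] (k * x ≡ q * n + y))
gcd∣⇒multiple-mod {suc n} {x} {zero} _ _ =
  suc n , s≤s z≤n , x , solve 2 (λ n x → (con 1 :+ n) :* x := x :* (con 1 :+ n) :+ con 0) refl n x
gcd∣⇒multiple-mod {n} {zero} {suc y} y<n n∣y =
  ⊥-elim (<⇒≱ y<n (∣⇒≤ (subst (_∣ suc y) (gcd-identityˡ n) n∣y)))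
gcd∣⇒multiple-mod {n} {suc x} {suc y} _ (divides c y≡cd) with gcd≡multiple-mod x n
... | k , q , eq = c * k , positive , c * q , kx≡
  where
  open ≡-Reasoning
  kx≡ : c * k * suc x ≡ c * q * n + suc y
  kx≡ = begin
    c * k * suc x                   ≡⟨ *-assoc c k (suc x) ⟩
    c * (k * suc x)                 ≡⟨ cong (c *_) eq ⟩
    c * (q * n + gcd (suc x) n)     ≡⟨ *-distribˡ-+ c (q * n) _ ⟩
    c * (q * n) + c * gcd (suc x) n ≡⟨ cong₂ _+_ (*-assoc c q n) y≡cd ⟨
    c * q * n + suc y               ∎
  positive : 1 ≤ c * k
  positive with c * k | kx≡
  ... | zero  | 0≡ = ⊥-elim (1+n≢0 (trans (sym (+-suc (c * q * n) y)) (sym 0≡)))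
  ... | suc _ | _  = s≤s z≤n

gcd∣⇒positivePower : ∀ {n} {x y : Fin n} → gcd (toℕ x) n ∣ toℕ y → IsPositivePower n y x
gcd∣⇒positivePower {y = y} = gcd∣⇒multiple-mod (toℕ<n y)

-- The cyclic subgroups generated by x and y are nested, since ⟨x⟩ = ⟨gcd x n⟩.
Nested : ℕ → ℕ → ℕ → Set
Nested n x y = gcd x n ∣ y ⊎ gcd y n ∣ x

powerAdj⇒nested : ∀ {n} {u v : Fin n} → PowerAdj n u v → Nested n (toℕ u) (toℕ v)
powerAdj⇒nested (_ , inj₁ v≈uᵏ) = inj₁ (positivePower⇒gcd∣ v≈uᵏ)
powerAdj⇒nested (_ , inj₂ u≈vᵏ) = inj₂ (positivePower⇒gcd∣ u≈vᵏ)

nested⇒powerAdj : ∀ {n} {u v : Fin n} → u ≢ v → Nested n (toℕ u) (toℕ v) → PowerAdj n u v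
nested⇒powerAdj u≢v (inj₁ d) = u≢v , inj₁ (gcd∣⇒positivePower d)
nested⇒powerAdj u≢v (inj₂ d) = u≢v , inj₂ (gcd∣⇒positivePower d)

powerAdj-sym : ∀ {n} {u v : Fin n} → PowerAdj n u v → PowerAdj n v u
powerAdj-sym (u≢v , inj₁ p) = ≢-sym u≢v , inj₂ p
powerAdj-sym (u≢v , inj₂ p) = ≢-sym u≢v , inj₁ p

module _ {n : ℕ} where
  open SimpleGraph (PowerAdj n) powerAdj-sym proj₁ public

vertices : ∀ {n} → Triangle {n} → Subset n
vertices T = ⁅ x ⁆ ∪ (⁅ y ⁆ ∪ ⁅ z ⁆)
  where open Triangle T

∈△⇒∈vertices : ∀ {n} {T : Triangle {n}} {v} → v ∈△ T → v ∈ₛ vertices T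
∈△⇒∈vertices (inj₁ refl)        = x∈p∪q⁺ (inj₁ (x∈⁅x⁆ _))
∈△⇒∈vertices (inj₂ (inj₁ refl)) = x∈p∪q⁺ (inj₂ (x∈p∪q⁺ (inj₁ (x∈⁅x⁆ _))))
∈△⇒∈vertices (inj₂ (inj₂ refl)) = x∈p∪q⁺ (inj₂ (x∈p∪q⁺ (inj₂ (x∈⁅x⁆ _))))

∈vertices⇒∈△ : ∀ {n} {T : Triangle {n}} {v} → v ∈ₛ vertices T → v ∈△ T
∈vertices⇒∈△ {T = T} v∈T =
  ⊎-map (x∈⁅y⁆⇒x≡y x) (⊎-map (x∈⁅y⁆⇒x≡y y) (x∈⁅y⁆⇒x≡y z) ∘ x∈p∪q⁻ ⁅ y ⁆ ⁅ z ⁆)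
    (x∈p∪q⁻ ⁅ x ⁆ _ v∈T)
  where
  open Triangle T

separable-of-two-triangles : ∀ {n} (T U : Triangle {n}) →
  (∀ {u v} → u ∈△ T → v ∈△ U → ¬ PowerAdj n u v) → CyclicallySeparablePowerGraph n
separable-of-two-triangles T U no-edge =
  S , two-triangles-cutset (_∈ₛ S) T U kept kept⁻ no-edge
  where
  S = ∁ (vertices T ∪ vertices U)
  kept : ∀ {v} → v ∈△ T ⊎ v ∈△ U → ¬ v ∈ₛ S
  kept v∈T∪U = x∈p⇒x∉∁p (x∈p∪q⁺ (⊎-map (∈△⇒∈vertices {T = T}) (∈△⇒∈vertices {T = U}) v∈T∪U))
  kept⁻ : ∀ {v} → ¬ v ∈ₛ S → v ∈△ T ⊎ v ∈△ U
  kept⁻ v∉S = ⊎-map (∈vertices⇒∈△ {T = T}) (∈vertices⇒∈△ {T = U}) (x∈p∪q⁻ _ _ (x∉∁p⇒x∈p v∉S))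

-- In the subgroup of order m of ℤ/n, where n = m a, the triangle has the vertices i a for these i.
triangleIndices : ℕ → ℕ → List ℕ
triangleIndices m j = 1 ∷ j ∷ m ∸ 1 ∷ []

TriangleShape : ℕ → ℕ → Set
TriangleShape m j = 2 ≤ j × 2 + j ≤ m

m*a≡[m∸1]*a+a : ∀ {m} a → 1 ≤ m → m * a ≡ (m ∸ 1) * a + a
m*a≡[m∸1]*a+a {suc m} a _ = +-comm a (m * a)

module SubgroupTriangle {n m a j : ℕ} .{{_ : NonZero a}} (n≡m*a : n ≡ m * a)
  (2≤j : 2 ≤ j) (2+j≤m : 2 + j ≤ m) where

  1≤m : 1 ≤ m
  1≤m = ≤-trans (s≤s z≤n) 2+j≤m

  a<ja : 1 * a < j * a
  a<ja = *-monoˡ-< a 2≤j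

  ja<[m∸1]a : j * a < (m ∸ 1) * a
  ja<[m∸1]a = *-monoˡ-< a (∸-monoˡ-≤ 1 2+j≤m)

  [m∸1]a<n : (m ∸ 1) * a < n
  [m∸1]a<n = subst ((m ∸ 1) * a <_) (sym n≡m*a) (*-monoˡ-< a (m∸1<m 1≤m))
    where
    m∸1<m : ∀ {m} → 1 ≤ m → m ∸ 1 < m
    m∸1<m {suc m} _ = ≤-refl

  ja<n : j * a < n
  ja<n = <-trans ja<[m∸1]a [m∸1]a<n

  a<n : 1 * a < n
  a<n = <-trans a<ja ja<n

  -- (m − 1) a generates the same subgroup as a.
  gcd∣a : gcd ((m ∸ 1) * a) n ∣ a
  gcd∣a = ∣m+n∣m⇒∣n
    (subst (gcd ((m ∸ 1) * a) n ∣_) (trans n≡m*a (m*a≡[m∸1]*a+a a 1≤m))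
      (gcd[m,n]∣n ((m ∸ 1) * a) n))
    (gcd[m,n]∣m ((m ∸ 1) * a) n)

  adjacent : ∀ i i′ (p : i * a < n) (q : i′ * a < n) → i * a < i′ * a →
    Nested n (i * a) (i′ * a) → PowerAdj n (fromℕ< p) (fromℕ< q)
  adjacent _ _ p q ia<i′a nested = nested⇒powerAdj
    (λ eq → <⇒≢ ia<i′a (trans (sym (toℕ-fromℕ< p)) (trans (cong toℕ eq) (toℕ-fromℕ< q))))
    (subst₂ (Nested n) (sym (toℕ-fromℕ< p)) (sym (toℕ-fromℕ< q)) nested)

  triangle : Triangle {n}
  triangle = record
    { x  = fromℕ< a<n
    ; y  = fromℕ< ja<n
    ; z  = fromℕ< [m∸1]a<n
    ; xy = adjacent 1 j a<n ja<n a<ja (inj₁ (∣-trans (gcd[m,n]∣m (1 * a) n) (*-monoˡ-∣ a (1∣ j))))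
    ; yz = adjacent j (m ∸ 1) ja<n [m∸1]a<n ja<[m∸1]a (inj₂ (∣-trans gcd∣a (n∣m*n j)))
    ; zx = powerAdj-sym (adjacent 1 (m ∸ 1) a<n [m∸1]a<n (<-trans a<ja ja<[m∸1]a)
             (inj₂ (∣-trans gcd∣a (n∣m*n 1))))
    }

  vertex-value : ∀ {v} → v ∈△ triangle → ∃[ i ] (i ∈ triangleIndices m j × toℕ v ≡ i * a)
  vertex-value (inj₁ refl)        = 1     , here refl                 , toℕ-fromℕ< a<n
  vertex-value (inj₂ (inj₁ refl)) = j     , there (here refl)         , toℕ-fromℕ< ja<n
  vertex-value (inj₂ (inj₂ refl)) = m ∸ 1 , there (there (here refl)) , toℕ-fromℕ< [m∸1]a<n

-- gcd (i a) n ∣ i′ b puts i′ b in ⟨a⟩, the subgroup of order m, so n = m′ b divides m i′ b.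
gcd[ia,n]∣i′b⇒m′∣i′m : ∀ {n m a m′ b} i i′ .{{_ : NonZero b}} → n ≡ m * a → n ≡ m′ * b →
  gcd (i * a) n ∣ i′ * b → m′ ∣ i′ * m
gcd[ia,n]∣i′b⇒m′∣i′m {n} {m} {a} {m′} {b} i i′ n≡m*a n≡m′*b g∣i′b
  with ∣-trans (gcd-greatest (n∣m*n i) (divides m n≡m*a)) g∣i′b
... | divides c i′b≡ca = divides c (*-cancelʳ-≡ (i′ * m) (c * m′) b (begin
  i′ * m * b   ≡⟨ solve 3 (λ i′ m b → i′ :* m :* b := m :* (i′ :* b)) refl i′ m b ⟩
  m * (i′ * b) ≡⟨ cong (m *_) i′b≡ca ⟩
  m * (c * a)  ≡⟨ solve 3 (λ m c a → m :* (c :* a) := c :* (m :* a)) refl m c a ⟩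
  c * (m * a)  ≡⟨ cong (c *_) (trans (sym n≡m*a) n≡m′*b) ⟩
  c * (m′ * b) ≡⟨ *-assoc c m′ b ⟨
  c * m′ * b   ∎))
  where open ≡-Reasoning

cofactor : ∀ {m n} .{{_ : NonZero n}} → m ∣ n → ∃[ a ] (NonZero a × n ≡ m * a)
cofactor {m} {suc n} (divides (suc a) n≡a*m) = suc a , _ , trans n≡a*m (*-comm (suc a) m)

separable-of-subgroup-triangles : ∀ {n m j m′ j′} .{{_ : NonZero n}} →
  m ∣ n → TriangleShape m j → m′ ∣ n → TriangleShape m′ j′ →
  All (λ i → ¬ m ∣ i * m′) (triangleIndices m j) →
  All (λ i′ → ¬ m′ ∣ i′ * m) (triangleIndices m′ j′) →
  CyclicallySeparablePowerGraph n
separable-of-subgroup-triangles {n} m∣n (2≤j , 2+j≤m) m′∣n (2≤j′ , 2+j′≤m′) T-safe U-safe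
  with cofactor m∣n | cofactor m′∣n
... | a , a≢0 , n≡m*a | b , b≢0 , n≡m′*b =
  separable-of-two-triangles T.triangle U.triangle no-edge
  where
  module T = SubgroupTriangle {{a≢0}} n≡m*a 2≤j 2+j≤m
  module U = SubgroupTriangle {{b≢0}} n≡m′*b 2≤j′ 2+j′≤m′
  no-edge : ∀ {u v} → u ∈△ T.triangle → v ∈△ U.triangle → ¬ PowerAdj n u v
  no-edge u∈T v∈U u~v with T.vertex-value u∈T | U.vertex-value v∈U | powerAdj⇒nested u~v
  ... | i , i∈T , u≡ia | i′ , i′∈U , v≡i′b | inj₁ g∣v =
    All.lookup U-safe i′∈U
      (gcd[ia,n]∣i′b⇒m′∣i′m i i′ {{b≢0}} n≡m*a n≡m′*b (subst₂ (λ x y → gcd x n ∣ y) u≡ia v≡i′b g∣v))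
  ... | i , i∈T , u≡ia | i′ , i′∈U , v≡i′b | inj₂ g∣u =
    All.lookup T-safe i∈T
      (gcd[ia,n]∣i′b⇒m′∣i′m i′ i {{a≢0}} n≡m′*b n≡m*a (subst₂ (λ x y → gcd x n ∣ y) v≡i′b u≡ia g∣u))

prime-divisor : ∀ {n} → 2 ≤ n → ∃[ p ] (Prime p × p ∣ n)
prime-divisor {suc zero} (s≤s ())
prime-divisor {suc (suc n)} _ with factorise (suc (suc n))
... | record { factors = [] ; isFactorisation = () }
... | record { factors = p ∷ ps ; isFactorisation = n≡p*ps ; factorsPrime = p-prime ∷ _ } =
  p , p-prime , divides (product ps) (trans n≡p*ps (*-comm p (product ps)))

prime-cases : ∀ {p} → Prime p → p ≡ 2 ⊎ p ≡ 3 ⊎ 5 ≤ p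
prime-cases {0} p-prime = ⊥-elim (¬prime[0] p-prime)
prime-cases {1} p-prime = ⊥-elim (¬prime[1] p-prime)
prime-cases {2} _ = inj₁ refl
prime-cases {3} _ = inj₂ (inj₁ refl)
prime-cases {4} p-prime = ⊥-elim (prime⇒¬composite p-prime composite[4])
prime-cases {suc (suc (suc (suc (suc _))))} _ = inj₂ (inj₂ (s≤s (s≤s (s≤s (s≤s (s≤s z≤n))))))

prime∧∤⇒coprime : ∀ {p m} → Prime p → ¬ p ∣ m → Coprime p m
prime∧∤⇒coprime p-prime p∤m (d∣p , d∣m) with prime⇒irreducible p-prime d∣p
... | inj₁ d≡1 = d≡1
... | inj₂ refl = ⊥-elim (p∤m d∣m)

prime≢⇒∤ : ∀ {p q} → Prime p → Prime q → p ≢ q → ¬ p ∣ q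
prime≢⇒∤ p-prime q-prime p≢q p∣q with prime⇒irreducible q-prime p∣q
... | inj₁ refl = ¬prime[1] p-prime
... | inj₂ p≡q  = p≢q p≡q

prime∤1 : ∀ {p} → Prime p → ¬ p ∣ 1
prime∤1 p-prime p∣1 = ¬prime[1] (subst Prime (∣1⇒≡1 p∣1) p-prime)

coprime⇒*∣ : ∀ {m m′ n} → Coprime m m′ → m ∣ n → m′ ∣ n → m * m′ ∣ n
coprime⇒*∣ {m} {m′} c m∣n (divides k n≡k*m′)
  with coprime-divisor c (subst (m ∣_) (trans n≡k*m′ (*-comm k m′)) m∣n)
... | divides d k≡d*m = divides d (trans n≡k*m′ (trans (cong (_* m′) k≡d*m) (*-assoc d m m′)))

∣-cofactor : ∀ {n k c d} → n ≡ k * c → d ∣ k → d * c ∣ n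
∣-cofactor {c = c} {d} n≡k*c d∣k = subst (d * c ∣_) (sym n≡k*c) (*-monoˡ-∣ c d∣k)

∣∸1⇒∣1 : ∀ {d m} → 1 ≤ m → d ∣ m → d ∣ m ∸ 1 → d ∣ 1
∣∸1⇒∣1 {d} {suc m} _ d∣1+m d∣m = ∣m+n∣m⇒∣n (subst (d ∣_) (+-comm 1 m) d∣1+m) d∣m

m∣n⇒n≡m⊎p*m∣n : ∀ {m n} .{{_ : NonZero n}} → m ∣ n → n ≡ m ⊎ ∃[ p ] (Prime p × p * m ∣ n)
m∣n⇒n≡m⊎p*m∣n {m} {n} (divides k n≡k*m) = by-cofactor k n≡k*m
  where
  by-cofactor : ∀ k → n ≡ k * m → n ≡ m ⊎ ∃[ p ] (Prime p × p * m ∣ n)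
  by-cofactor 0               n≡0   = ⊥-elim (≢-nonZero⁻¹ n n≡0)
  by-cofactor 1               n≡1*m = inj₁ (trans n≡1*m (*-identityˡ m))
  by-cofactor k@(suc (suc _)) n≡k*m with prime-divisor {k} (s≤s (s≤s z≤n))
  ... | p , p-prime , p∣k = inj₂ (p , p-prime , ∣-cofactor {c = m} n≡k*m p∣k)

triangleIndices-bounds : ∀ {m j} → TriangleShape m j →
  All (λ i → 1 ≤ i × i < m) (triangleIndices m j)
triangleIndices-bounds {suc zero} (_ , s≤s ())
triangleIndices-bounds {suc (suc m)} {j} (2≤j , 2+j≤m) =
  (≤-refl , s≤s (s≤s z≤n)) ∷ (≤-trans (s≤s z≤n) 2≤j , ≤-trans (n≤1+n _) 2+j≤m) ∷
  (s≤s z≤n , ≤-refl) ∷ []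

coprime⇒triangle-safe : ∀ {m m′ j} → Coprime m m′ → TriangleShape m j →
  All (λ i → ¬ m ∣ i * m′) (triangleIndices m j)
coprime⇒triangle-safe {m} {m′} c shape = All.map safe (triangleIndices-bounds shape)
  where
  safe : ∀ {i} → 1 ≤ i × i < m → ¬ m ∣ i * m′
  safe {i} (1≤i , i<m) m∣i*m′ =
    <⇒≱ i<m (∣⇒≤ {{>-nonZero 1≤i}} (coprime-divisor c (subst (m ∣_) (*-comm i m′) m∣i*m′)))

separable-of-coprime : ∀ {n m m′} .{{_ : NonZero n}} → m ∣ n → m′ ∣ n → 4 ≤ m → 4 ≤ m′ →
  Coprime m m′ → CyclicallySeparablePowerGraph n
separable-of-coprime m∣n m′∣n 4≤m 4≤m′ c = separable-of-subgroup-triangles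
  m∣n (≤-refl , 4≤m) m′∣n (≤-refl , 4≤m′)
  (coprime⇒triangle-safe c (≤-refl , 4≤m)) (coprime⇒triangle-safe (Coprime.sym c) (≤-refl , 4≤m′))

prime∤triangleIndices : ∀ {q r j} → Prime q → ¬ q ∣ j → 1 ≤ r →
  All (λ i → ¬ q ∣ i) (triangleIndices (q * r) j)
prime∤triangleIndices {q} {r} q-prime q∤j 1≤r =
  prime∤1 q-prime ∷ q∤j ∷ (prime∤1 q-prime ∘ ∣∸1⇒∣1 1≤qr (m∣m*n r)) ∷ []
  where
  1≤qr : 1 ≤ q * r
  1≤qr = *-mono-≤ (≤-trans (s≤s z≤n) (nonTrivial⇒n>1 q {{prime⇒nonTrivial q-prime}})) 1≤r

q*r∣i*[s*r]⇒q∣i : ∀ {q r s i} → Prime q → ¬ q ∣ s → .{{_ : NonZero r}} → q * r ∣ i * (s * r) → q ∣ i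
q*r∣i*[s*r]⇒q∣i {q} {r} {s} {i} q-prime q∤s qr∣isr
  with euclidsLemma i s q-prime (*-cancelʳ-∣ r (subst (q * r ∣_) (sym (*-assoc i s r)) qr∣isr))
... | inj₁ q∣i = q∣i
... | inj₂ q∣s = ⊥-elim (q∤s q∣s)

-- Triangles in the subgroups of orders p r and r², with p ∤ r and r ∤ 2 ruling out the cross edges.
separable-of-p*r*r : ∀ {n p r} .{{_ : NonZero n}} → Prime p → Prime r → p ≢ r → 3 ≤ r →
  p ∣ n → r * r ∣ n → CyclicallySeparablePowerGraph n
separable-of-p*r*r {n} {p} {r} p-prime r-prime p≢r 3≤r p∣n r*r∣n =
  separable-of-subgroup-triangles
    (coprime⇒*∣ (prime∧∤⇒coprime p-prime p∤r) p∣n (∣-trans (m∣m*n r) r*r∣n)) (2≤r , 2+r≤p*r)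
    r*r∣n (≤-refl , *-mono-≤ 2≤r 2≤r)
    (All.map (λ p∤i → p∤i ∘ q*r∣i*[s*r]⇒q∣i p-prime p∤r) (prime∤triangleIndices p-prime p∤r 1≤r))
    (All.map (λ r∤i → r∤i ∘ q*r∣i*[s*r]⇒q∣i r-prime r∤p) (prime∤triangleIndices r-prime r∤2 1≤r))
  where
  instance _ = prime⇒nonZero r-prime
  2≤r : 2 ≤ r
  2≤r = nonTrivial⇒n>1 r {{prime⇒nonTrivial r-prime}}
  1≤r : 1 ≤ r
  1≤r = ≤-trans (s≤s z≤n) 2≤r
  p∤r = prime≢⇒∤ p-prime r-prime p≢r
  r∤p = prime≢⇒∤ r-prime p-prime (≢-sym p≢r)
  r∤2 : ¬ r ∣ 2
  r∤2 r∣2 = <⇒≱ 3≤r (∣⇒≤ r∣2)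
  2+r≤p*r : 2 + r ≤ p * r
  2+r≤p*r = begin
    2 + r     ≤⟨ +-monoˡ-≤ r 2≤r ⟩
    r + r     ≡⟨ cong (r +_) (+-identityʳ r) ⟨
    2 * r     ≤⟨ *-monoˡ-≤ r (nonTrivial⇒n>1 p {{prime⇒nonTrivial p-prime}}) ⟩
    p * r     ∎
    where open ≤-Reasoning

separable-of-24∣ : ∀ {n} .{{_ : NonZero n}} → 24 ∣ n → CyclicallySeparablePowerGraph n
separable-of-24∣ 24∣n = separable-of-subgroup-triangles
  (∣-trans (divides 4 refl) 24∣n) (≤-refl , m≤m+n 4 2)
  (∣-trans (divides 3 refl) 24∣n) (≤-refl , m≤m+n 4 4)
  (from-no (6 ∣? 1 * 8) ∷ from-no (6 ∣? 2 * 8) ∷ from-no (6 ∣? 5 * 8) ∷ [])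
  (from-no (8 ∣? 1 * 6) ∷ from-no (8 ∣? 2 * 6) ∷ from-no (8 ∣? 7 * 6) ∷ [])

prime[3] : Prime 3
prime[3] = from-yes (prime? 3)

5≤⇒≢2 : ∀ {u} → 5 ≤ u → 2 ≢ u
5≤⇒≢2 (s≤s (s≤s ())) refl

separable-of-large-prime : ∀ {n u p} .{{_ : NonZero n}} → Prime u → 5 ≤ u → Prime p → p ≢ u →
  u ∣ n → p ∣ n → ¬ IsSmallSemiprime n → CyclicallySeparablePowerGraph n
separable-of-large-prime {n} {u} {p} u-prime 5≤u p-prime p≢u u∣n@(divides k n≡k*u) p∣n not-semi
  with u ∣? k
... | yes u∣k = separable-of-p*r*r p-prime u-prime p≢u 3≤u p∣n (∣-cofactor n≡k*u u∣k)
  where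
  3≤u = ≤-trans (n≤1+n 3) (≤-trans (n≤1+n 4) 5≤u)
... | no u∤k = by-cofactor k n≡k*u u∤k
  where
  by-cofactor : ∀ k → n ≡ k * u → ¬ u ∣ k → CyclicallySeparablePowerGraph n
  by-cofactor 0 n≡0 _ = ⊥-elim (≢-nonZero⁻¹ n n≡0)
  by-cofactor 1 n≡u _ =
    ⊥-elim (prime≢⇒∤ p-prime u-prime p≢u (subst (p ∣_) (trans n≡u (*-identityˡ u)) p∣n))
  by-cofactor 2 n≡2u _ =
    ⊥-elim (not-semi (2 , u , prime[2] , u-prime , ≤-trans (m≤m+n 3 2) 5≤u , inj₁ refl , n≡2u))
  by-cofactor 3 n≡3u _ =
    ⊥-elim (not-semi (3 , u , prime[3] , u-prime , ≤-trans (m≤m+n 4 1) 5≤u , inj₂ refl , n≡3u))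
  by-cofactor k@(suc (suc (suc (suc _)))) n≡ku u∤k = separable-of-coprime
    u∣n (divides u (trans n≡ku (*-comm k u))) (≤-trans (n≤1+n 4) 5≤u) (m≤m+n 4 _)
    (prime∧∤⇒coprime u-prime u∤k)

separable-of-12∣ : ∀ {n} .{{_ : NonZero n}} → 12 ∣ n → ¬ IsSmallSemiprime n → n ≢ 12 →
  CyclicallySeparablePowerGraph n
separable-of-12∣ 12∣n not-semi n≢12 with m∣n⇒n≡m⊎p*m∣n 12∣n
... | inj₁ n≡12 = ⊥-elim (n≢12 n≡12)
... | inj₂ (u , u-prime , u*12∣n) with prime-cases u-prime
...   | inj₁ refl        = separable-of-24∣ u*12∣n
...   | inj₂ (inj₁ refl) = separable-of-p*r*r prime[2] prime[3] (λ ()) ≤-refl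
  (∣-trans (divides 6 refl) 12∣n) (∣-trans (divides 4 refl) u*12∣n)
...   | inj₂ (inj₂ 5≤u)  = separable-of-large-prime u-prime 5≤u prime[2] (5≤⇒≢2 5≤u)
  (∣-trans (m∣m*n 12) u*12∣n) (∣-trans (divides 6 refl) 12∣n) not-semi

separable-of-6∣ : ∀ {n} .{{_ : NonZero n}} → 6 ∣ n → ¬ IsSmallSemiprime n → n ≢ 12 →
  CyclicallySeparablePowerGraph n
separable-of-6∣ 6∣n not-semi n≢12 with m∣n⇒n≡m⊎p*m∣n 6∣n
... | inj₁ n≡6 = ⊥-elim (not-semi (2 , 3 , prime[2] , prime[3] , ≤-refl , inj₁ refl , n≡6))
... | inj₂ (u , u-prime , u*6∣n) with prime-cases u-prime
...   | inj₁ refl        = separable-of-12∣ u*6∣n not-semi n≢12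
...   | inj₂ (inj₁ refl) = separable-of-p*r*r prime[2] prime[3] (λ ()) ≤-refl
  (∣-trans (divides 3 refl) 6∣n) (∣-trans (divides 2 refl) u*6∣n)
...   | inj₂ (inj₂ 5≤u)  = separable-of-large-prime u-prime 5≤u prime[2] (5≤⇒≢2 5≤u)
  (∣-trans (m∣m*n 6) u*6∣n) (∣-trans (divides 3 refl) 6∣n) not-semi

separable-if : ∀ {n} .{{_ : NonZero n}} → HasTwoDistinctPrimeFactors n → ¬ IsSmallSemiprime n →
  n ≢ 12 → CyclicallySeparablePowerGraph n
separable-if (p , q , p-prime , q-prime , p≢q , p∣n , q∣n) not-semi n≢12
  with prime-cases p-prime | prime-cases q-prime
... | _ | inj₂ (inj₂ 5≤q) =
  separable-of-large-prime q-prime 5≤q p-prime p≢q q∣n p∣n not-semi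
... | inj₂ (inj₂ 5≤p) | _ =
  separable-of-large-prime p-prime 5≤p q-prime (≢-sym p≢q) p∣n q∣n not-semi
... | inj₁ refl        | inj₁ refl        = ⊥-elim (p≢q refl)
... | inj₂ (inj₁ refl) | inj₂ (inj₁ refl) = ⊥-elim (p≢q refl)
... | inj₁ refl        | inj₂ (inj₁ refl) =
  separable-of-6∣ (coprime⇒*∣ (from-yes (coprime? 2 3)) p∣n q∣n) not-semi n≢12
... | inj₂ (inj₁ refl) | inj₁ refl =
  separable-of-6∣ (coprime⇒*∣ (from-yes (coprime? 2 3)) q∣n p∣n) not-semi n≢12

product≡p^length : ∀ {p} (ps : List ℕ) → All (_≡ p) ps → product ps ≡ p ^ length ps
product≡p^length []       []        = refl
product≡p^length {p} (_ ∷ ps) (refl ∷ eq) = cong (p *_) (product≡p^length ps eq)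

other-prime-or-all≡ : ∀ p qs → All Prime qs →
  ∃[ q ] (Prime q × q ≢ p × q ∣ product qs) ⊎ All (_≡ p) qs
other-prime-or-all≡ p []       []                   = inj₂ []
other-prime-or-all≡ p (q ∷ qs) (q-prime ∷ qs-prime) with q ≟ p | other-prime-or-all≡ p qs qs-prime
... | no q≢p  | _                                = inj₁ (q , q-prime , q≢p , m∣m*n (product qs))
... | yes _   | inj₁ (r , r-prime , r≢p , r∣qs) = inj₁ (r , r-prime , r≢p , ∣n⇒∣m*n q r∣qs)
... | yes q≡p | inj₂ qs≡p                        = inj₂ (q≡p ∷ qs≡p)

two-primes-or-prime-power : ∀ n .{{_ : NonZero n}} →
  HasTwoDistinctPrimeFactors n ⊎ ∃[ p ] ∃[ k ] (Prime p × n ≡ p ^ k)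
two-primes-or-prime-power n with factorise n
... | record { factors = [] ; isFactorisation = n≡1 } = inj₂ (2 , 0 , prime[2] , n≡1)
... | record { factors = p ∷ ps ; isFactorisation = n≡p*ps ; factorsPrime = p-prime ∷ ps-prime }
  with other-prime-or-all≡ p ps ps-prime
... | inj₁ (q , q-prime , q≢p , q∣ps) = inj₁
  (p , q , p-prime , q-prime , ≢-sym q≢p ,
   subst (p ∣_) (sym n≡p*ps) (m∣m*n (product ps)) , subst (q ∣_) (sym n≡p*ps) (∣n⇒∣m*n p q∣ps))
... | inj₂ ps≡p = inj₂ (p , suc (length ps) , p-prime ,
  trans n≡p*ps (cong (p *_) (product≡p^length ps ps≡p)))

∣p^k⇒≡p^i : ∀ {p d} k → Prime p → d ∣ p ^ k → ∃[ i ] d ≡ p ^ i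
∣p^k⇒≡p^i zero    _       d∣1     = 0 , ∣1⇒≡1 d∣1
∣p^k⇒≡p^i {p} {d} (suc k) p-prime d∣p^[1+k] with p ∣? d
... | no p∤d =
  ∣p^k⇒≡p^i k p-prime (coprime-divisor (Coprime.sym (prime∧∤⇒coprime p-prime p∤d)) d∣p^[1+k])
... | yes (divides e d≡e*p) with ∣p^k⇒≡p^i k p-prime (*-cancelˡ-∣ p {{prime⇒nonZero p-prime}}
        (subst (_∣ p * p ^ k) (trans d≡e*p (*-comm e p)) d∣p^[1+k]))
...   | i , e≡p^i = suc i , trans d≡e*p (trans (cong (_* p) e≡p^i) (*-comm (p ^ i) p))

p^i∣p^j : ∀ p {i j} → i ≤ j → p ^ i ∣ p ^ j
p^i∣p^j p {i} {j} i≤j = divides (p ^ (j ∸ i)) (begin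
  p ^ j               ≡⟨ cong (p ^_) (m+[n∸m]≡n i≤j) ⟨
  p ^ (i + (j ∸ i))   ≡⟨ ^-distribˡ-+-* p i (j ∸ i) ⟩
  p ^ i * p ^ (j ∸ i) ≡⟨ *-comm (p ^ i) (p ^ (j ∸ i)) ⟩
  p ^ (j ∸ i) * p ^ i ∎)
  where open ≡-Reasoning

-- In ℤ/pᵏ the cyclic subgroups form a chain, so the power graph is complete.
¬separable-prime-power : ∀ {n p k} → Prime p → n ≡ p ^ k → ¬ CyclicallySeparablePowerGraph n
¬separable-prime-power {n} {p} {k} p-prime n≡p^k (S , cutset) =
  no-cyclic-cutset (λ _ → ⊤) (λ _ → yes tt) _≟ᶠ_ complete (λ u∉K _ _ _ _ _ → u∉K tt) _ cutset
  where
  complete : ∀ {u v : Fin n} → ⊤ → ⊤ → u ≢ v → PowerAdj n u v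
  complete {u} {v} _ _ u≢v
    with ∣p^k⇒≡p^i k p-prime (subst (gcd (toℕ u) n ∣_) n≡p^k (gcd[m,n]∣n (toℕ u) n))
       | ∣p^k⇒≡p^i k p-prime (subst (gcd (toℕ v) n ∣_) n≡p^k (gcd[m,n]∣n (toℕ v) n))
  ... | i , gu≡p^i | j , gv≡p^j with ≤-total i j
  ... | inj₁ i≤j = nested⇒powerAdj u≢v (inj₁
    (∣-trans (subst₂ _∣_ (sym gu≡p^i) (sym gv≡p^j) (p^i∣p^j p i≤j)) (gcd[m,n]∣m (toℕ v) n)))
  ... | inj₂ j≤i = nested⇒powerAdj u≢v (inj₂
    (∣-trans (subst₂ _∣_ (sym gv≡p^j) (sym gu≡p^i) (p^i∣p^j p j≤i)) (gcd[m,n]∣m (toℕ u) n)))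

pigeonhole : ∀ {A : Set} {a b x y z : A} → x ≡ a ⊎ x ≡ b → y ≡ a ⊎ y ≡ b → z ≡ a ⊎ z ≡ b →
  x ≡ y ⊎ y ≡ z ⊎ x ≡ z
pigeonhole (inj₁ refl) (inj₁ refl) _           = inj₁ refl
pigeonhole (inj₂ refl) (inj₂ refl) _           = inj₁ refl
pigeonhole _           (inj₁ refl) (inj₁ refl) = inj₂ (inj₁ refl)
pigeonhole _           (inj₂ refl) (inj₂ refl) = inj₂ (inj₁ refl)
pigeonhole (inj₁ refl) (inj₂ refl) (inj₁ refl) = inj₂ (inj₂ refl)
pigeonhole (inj₂ refl) (inj₁ refl) (inj₂ refl) = inj₂ (inj₂ refl)

-- The clique is 0 together with the non-multiples of q, whose gcd with n divides p; the
-- only other vertices are q and 2q, which carry no path on three vertices.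
¬separable-p*q : ∀ {n p q} → Prime p → Prime q → p ≤ 3 → n ≡ p * q →
  ¬ CyclicallySeparablePowerGraph n
¬separable-p*q {n} {p} {q} p-prime q-prime p≤3 n≡p*q (S , cutset) =
  no-cyclic-cutset K K? _≟ᶠ_ clique no-path _ cutset
  where
  K : Fin n → Set
  K v = q ∣ toℕ v → toℕ v ≡ 0
  K? : ∀ v → Dec (K v)
  K? v = (q ∣? toℕ v) →-dec (toℕ v ≟ 0)
  ¬K⇒value : ∀ {v} → ¬ K v → toℕ v ≡ 1 * q ⊎ toℕ v ≡ 2 * q
  ¬K⇒value {v} v∉K with q ∣? toℕ v | toℕ v ≟ 0
  ... | no q∤v     | _      = ⊥-elim (v∉K (⊥-elim ∘ q∤v))
  ... | yes _      | yes v≡0 = ⊥-elim (v∉K (λ _ → v≡0))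
  ... | yes (divides c v≡c*q) | no v≢0
    with c | v≡c*q | *-cancelʳ-< q c p (subst₂ _<_ v≡c*q n≡p*q (toℕ<n v))
  ...   | 0 | v≡0  | _ = ⊥-elim (v≢0 v≡0)
  ...   | 1 | v≡q  | _ = inj₁ v≡q
  ...   | 2 | v≡2q | _ = inj₂ v≡2q
  ...   | suc (suc (suc _)) | _ | c<p = ⊥-elim (<⇒≱ c<p (≤-trans p≤3 (s≤s (s≤s (s≤s z≤n)))))
  no-path : ∀ {u v w} → ¬ K u → ¬ K v → ¬ K w → u ≢ w → PowerAdj n u v → PowerAdj n v w → ⊥
  no-path u∉K v∉K w∉K u≢w (u≢v , _) (v≢w , _)
    with pigeonhole (¬K⇒value u∉K) (¬K⇒value v∉K) (¬K⇒value w∉K)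
  ... | inj₁ u≡v        = u≢v (toℕ-injective u≡v)
  ... | inj₂ (inj₁ v≡w) = v≢w (toℕ-injective v≡w)
  ... | inj₂ (inj₂ u≡w) = u≢w (toℕ-injective u≡w)
  gcd-cases : ∀ {v} → K v → toℕ v ≡ 0 ⊎ gcd (toℕ v) n ∣ p
  gcd-cases {v} v∈K with toℕ v ≟ 0
  ... | yes v≡0 = inj₁ v≡0
  ... | no v≢0  = inj₂ (coprime-divisor (Coprime.sym (prime∧∤⇒coprime q-prime q∤g))
                   (subst (gcd (toℕ v) n ∣_) (trans n≡p*q (*-comm p q)) (gcd[m,n]∣n (toℕ v) n)))
    where
    q∤g : ¬ q ∣ gcd (toℕ v) n
    q∤g q∣g = v≢0 (v∈K (∣-trans q∣g (gcd[m,n]∣m (toℕ v) n)))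
  clique : ∀ {u v} → K u → K v → u ≢ v → PowerAdj n u v
  clique {u} {v} u∈K v∈K u≢v = nested⇒powerAdj u≢v (nested (gcd-cases u∈K) (gcd-cases v∈K))
    where
    nested : toℕ u ≡ 0 ⊎ gcd (toℕ u) n ∣ p → toℕ v ≡ 0 ⊎ gcd (toℕ v) n ∣ p →
      Nested n (toℕ u) (toℕ v)
    nested (inj₁ u≡0) _ = inj₂ (subst (gcd (toℕ v) n ∣_) (sym u≡0) (_ ∣0))
    nested _ (inj₁ v≡0) = inj₁ (subst (gcd (toℕ u) n ∣_) (sym v≡0) (_ ∣0))
    nested (inj₂ gu∣p) (inj₂ gv∣p)
      with prime⇒irreducible p-prime gu∣p | prime⇒irreducible p-prime gv∣p
    ... | inj₁ gu≡1 | _         = inj₁ (subst (_∣ toℕ v) (sym gu≡1) (1∣ toℕ v))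
    ... | _         | inj₁ gv≡1 = inj₂ (subst (_∣ toℕ u) (sym gv≡1) (1∣ toℕ u))
    ... | inj₂ gu≡p | inj₂ gv≡p =
      inj₁ (subst (_∣ toℕ v) (trans gv≡p (sym gu≡p)) (gcd[m,n]∣m (toℕ v) n))

-- The divisors 1, 2, 6, 12 of 12 form a chain; the remaining vertices 3, 9 (gcd 3) and 4, 8
-- (gcd 4) carry only the two edges 3 – 9 and 4 – 8.
¬separable-12 : ¬ CyclicallySeparablePowerGraph 12
¬separable-12 (S , cutset) = no-cyclic-cutset K K? _≟ᶠ_ clique no-path _ cutset
  where
  K : Fin 12 → Set
  K v = gcd (toℕ v) 12 ≢ 3 × gcd (toℕ v) 12 ≢ 4
  K? : ∀ v → Dec (K v)
  K? v = ¬? (gcd (toℕ v) 12 ≟ 3) ×-dec ¬? (gcd (toℕ v) 12 ≟ 4)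
  nested? : ∀ (u v : Fin 12) → Dec (Nested 12 (toℕ u) (toℕ v))
  nested? u v = (gcd (toℕ u) 12 ∣? toℕ v) ⊎-dec (gcd (toℕ v) 12 ∣? toℕ u)
  K-nested : ∀ u v → K u → K v → Nested 12 (toℕ u) (toℕ v)
  K-nested = from-yes (all? λ u → all? λ v → K? u →-dec (K? v →-dec nested? u v))
  ¬K-matching : ∀ u v w → ¬ K u → ¬ K v → ¬ K w → u ≢ v → v ≢ w → u ≢ w →
    ¬ (Nested 12 (toℕ u) (toℕ v) × Nested 12 (toℕ v) (toℕ w))
  ¬K-matching = from-yes (all? λ u → all? λ v → all? λ w →
    ¬? (K? u) →-dec (¬? (K? v) →-dec (¬? (K? w) →-dec
    (¬? (u ≟ᶠ v) →-dec (¬? (v ≟ᶠ w) →-dec (¬? (u ≟ᶠ w) →-dec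
    ¬? (nested? u v ×-dec nested? v w)))))))
  clique : ∀ {u v} → K u → K v → u ≢ v → PowerAdj 12 u v
  clique {u} {v} u∈K v∈K u≢v = nested⇒powerAdj u≢v (K-nested u v u∈K v∈K)
  no-path : ∀ {u v w} → ¬ K u → ¬ K v → ¬ K w → u ≢ w → PowerAdj 12 u v → PowerAdj 12 v w → ⊥
  no-path {u} {v} {w} u∉K v∉K w∉K u≢w u~v v~w = ¬K-matching u v w u∉K v∉K w∉K
    (proj₁ u~v) (proj₁ v~w) u≢w (powerAdj⇒nested u~v , powerAdj⇒nested v~w)

mainTheorem1 : (n : ℕ) → 1 ≤ n →
    CyclicallySeparablePowerGraph n ⇔
      (HasTwoDistinctPrimeFactors n × ¬ IsSmallSemiprime n × n ≢ 12)
mainTheorem1 n 1≤n =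
  mk⇔ necessary (λ (two-primes , not-semi , n≢12) → separable-if two-primes not-semi n≢12)
  where
  instance _ = >-nonZero 1≤n
  necessary : CyclicallySeparablePowerGraph n →
    HasTwoDistinctPrimeFactors n × ¬ IsSmallSemiprime n × n ≢ 12
  necessary separable = two-primes , not-semi , n≢12
    where
    two-primes : HasTwoDistinctPrimeFactors n
    two-primes with two-primes-or-prime-power n
    ... | inj₁ two = two
    ... | inj₂ (p , k , p-prime , n≡p^k) =
      ⊥-elim (¬separable-prime-power {k = k} p-prime n≡p^k separable)
    not-semi : ¬ IsSmallSemiprime n
    not-semi (p₁ , p₂ , p₁-prime , p₂-prime , _ , p₁∈23 , n≡p₁p₂) =
      ¬separable-p*q p₁-prime p₂-prime ([ (λ { refl → m≤m+n 2 1 }) , ≤-reflexive ]′ p₁∈23)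
        n≡p₁p₂ separable
    n≢12 : n ≢ 12
    n≢12 refl = ¬separable-12 separable
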